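{- Let $t$ be a CBV term, $u'$ a Bang term, $F$ a full context of the Distant Bang Calculus and $R'\in\{dB,s!,d!\}$. Suppose $u'$ is an $F\langle d!\rangle$-normal form (no $d!$-step in any full context). If $t^{v}\to_{F\langle R'\rangle}\to_{F\langle d!\rangle}^* u'$ (one $R'$-step in the full context $F$ followed by zero or more full $d!$-steps), then there exist a CBV term $u$ with $u^{v}=u'$, a rule $R\in\{dB,sV\}$ with $R^{v}=R'$, and a CBV full context $G$ such that $t\to_{G\langle R\rangle} u$.
   Context: Distant Bang Calculus. Terms: $t,u,s ::= x \mid t\,u \mid \lambda x.t \mid !t \mid \mathrm{der}(t) \mid t[x\backslash u]$; $\lambda x.t$ and $t[x\backslash u]$ bind $x$ in $t$; terms up to $\alpha$-conversion; $t\{x:=u\}$ is capture-avoiding substitution. Contexts have exactly one hole $\square$, $C\langle t\rangle$ is plugging. Full contexts: $F ::= \square \mid F\,t \mid t\,F \mid \lambda x.F \mid !F \mid \mathrm{der}(F) \mid F[x\backslash t] \mid t[x\backslash F]$; list contexts $L ::= \square \mid L[x\backslash t]$. Rules (capture-free w.r.t. $L$): $(dB)$ $L\langle \lambda x.t\rangle\,u \mapsto L\langle t[x\backslash u]\rangle$; $(s!)$ $t[x\backslash L\langle !u\rangle] \mapsto L\langle t\{x:=u\}\rangle$; $(d!)$ $\mathrm{der}(L\langle !t\rangle) \mapsto L\langle t\rangle$. $C\langle t\rangle \to_{C\langle R\rangle} C\langle u\rangle$ whenever $t\mapsto_R u$. CBV calculus. Terms $t,u ::= v \mid t\,u \mid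 t[x\backslash u]$, values $v ::= x \mid \lambda x.t$; full contexts $G ::= \square \mid G\,t \mid t\,G \mid \lambda x.G \mid G[x\backslash t] \mid t[x\backslash G]$; list contexts $L ::= \square \mid L[x\backslash t]$. Rules (capture-free): $(dB)$ $L\langle \lambda x.t\rangle\,u \mapsto L\langle t[x\backslash u]\rangle$, $(sV)$ $t[x\backslash L\langle v\rangle]\mapsto L\langle t\{x:=v\}\rangle$ with $v$ a value. $t\to_{G\langle R\rangle}u$ means $t=G\langle t'\rangle$, $u=G\langle u'\rangle$, $t'\mapsto_R u'$. CBV embedding $(\cdot)^v$: $x^v=!x$; $(\lambda x.t)^v=!\lambda x.!t^v$; $(t[x\backslash u])^v=t^v[x\backslash u^v]$; $(t\,u)^v=\mathrm{der}(L\langle s\rangle\,u^v)$ if $t^v=L\langle !s\rangle$ for some list context $L$ and term $s$, and $(t\,u)^v=\mathrm{der}(\mathrm{der}(t^v)\,u^v)$ otherwise. On rule names: $dB^v=dB$, $sV^v=s!$. -}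

module Defs where

open import Data.Nat using (ℕ; zero; suc)
open import Data.Fin using (Fin; zero; suc)
open import Data.Maybe using (Maybe; just; nothing)
open import Data.Product using (Σ; _×_; _,_)
open import Function using (id; _∘_)
open import Relation.Nullary using (¬_)

-- Terms are well-scoped de Bruijn terms (Tm n: at most n free variables),
-- so α-equivalence is syntactic equality.

Ren : ℕ → ℕ → Set
Ren n m = Fin n → Fin m

ext : ∀ {n m} → Ren n m → Ren (suc n) (suc m)
ext ρ zero = zero
ext ρ (suc i) = suc (ρ i)

data Tm (n : ℕ) : Set where
  var  : Fin n → Tm n
  app  : Tm n → Tm n → Tm n
  lam  : Tm (suc n) → Tm n
  bang : Tm n → Tm n
  der  : Tm n → Tm n
  es   : Tm (suc n) → Tm n → Tm n     -- es t u = t[x\u]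

rename : ∀ {n m} → Ren n m → Tm n → Tm m
rename ρ (var i) = var (ρ i)
rename ρ (app t u) = app (rename ρ t) (rename ρ u)
rename ρ (lam t) = lam (rename (ext ρ) t)
rename ρ (bang t) = bang (rename ρ t)
rename ρ (der t) = der (rename ρ t)
rename ρ (es t u) = es (rename (ext ρ) t) (rename ρ u)

Sub : ℕ → ℕ → Set
Sub n m = Fin n → Tm m

exts : ∀ {n m} → Sub n m → Sub (suc n) (suc m)
exts σ zero = var zero
exts σ (suc i) = rename suc (σ i)

subst : ∀ {n m} → Sub n m → Tm n → Tm m
subst σ (var i) = σ i
subst σ (app t u) = app (subst σ t) (subst σ u)
subst σ (lam t) = lam (subst (exts σ) t)
subst σ (bang t) = bang (subst σ t)
subst σ (der t) = der (subst σ t)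
subst σ (es t u) = es (subst (exts σ) t) (subst σ u)

subst0 : ∀ {n} → Tm (suc n) → Tm n → Tm n
subst0 {n} t u = subst σ t
  where
  σ : Sub (suc n) n
  σ zero = u
  σ (suc i) = var i

-- List contexts  L ::= □ | L[x\t].  LCtx n m: the hole is in scope m.
data LCtx : ℕ → ℕ → Set where
  □    : ∀ {n} → LCtx n n
  _[_] : ∀ {n m} → LCtx (suc n) m → Tm n → LCtx n m

plug : ∀ {n m} → LCtx n m → Tm m → Tm n
plug □ s = s
plug (L [ t ]) s = es (plug L s) t

-- weakening of a term from outside L to the scope of L's hole
-- (this is the capture-freeness side condition)
wkL : ∀ {n m} → LCtx n m → Ren n m
wkL □ = id
wkL (L [ t ]) = wkL L ∘ suc

data BRule : Set where
  dB s! d! : BRule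

data _↦[_]_ {n : ℕ} : Tm n → BRule → Tm n → Set where
  ↦dB : ∀ {m} (L : LCtx n m) (t : Tm (suc m)) (u : Tm n) →
        app (plug L (lam t)) u ↦[ dB ] plug L (es t (rename (wkL L) u))
  ↦s! : ∀ {m} (t : Tm (suc n)) (L : LCtx n m) (u : Tm m) →
        es t (plug L (bang u)) ↦[ s! ] plug L (subst0 (rename (ext (wkL L)) t) u)
  ↦d! : ∀ {m} (L : LCtx n m) (t : Tm m) →
        der (plug L (bang t)) ↦[ d! ] plug L t

-- closure under full contexts F:  t →_{F⟨R⟩} u  (for some full context F)
data _⟶[_]_ : ∀ {n} → Tm n → BRule → Tm n → Set where
  root  : ∀ {n R} {t u : Tm n} → t ↦[ R ] u → t ⟶[ R ] u
  appL  : ∀ {n R} {t t' : Tm n} (u : Tm n) → t ⟶[ R ] t' → app t u ⟶[ R ] app t' u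
  appR  : ∀ {n R} {u u' : Tm n} (t : Tm n) → u ⟶[ R ] u' → app t u ⟶[ R ] app t u'
  lamC  : ∀ {n R} {t t' : Tm (suc n)} → t ⟶[ R ] t' → lam t ⟶[ R ] lam t'
  bangC : ∀ {n R} {t t' : Tm n} → t ⟶[ R ] t' → bang t ⟶[ R ] bang t'
  derC  : ∀ {n R} {t t' : Tm n} → t ⟶[ R ] t' → der t ⟶[ R ] der t'
  esL   : ∀ {n R} {t t' : Tm (suc n)} (u : Tm n) → t ⟶[ R ] t' → es t u ⟶[ R ] es t' u
  esR   : ∀ {n R} {u u' : Tm n} (t : Tm (suc n)) → u ⟶[ R ] u' → es t u ⟶[ R ] es t u'

data VTm (n : ℕ) : Set where
  var : Fin n → VTm n
  lam : VTm (suc n) → VTm n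
  app : VTm n → VTm n → VTm n
  es  : VTm (suc n) → VTm n → VTm n

data Value {n : ℕ} : VTm n → Set where
  var : (i : Fin n) → Value (var i)
  lam : (t : VTm (suc n)) → Value (lam t)

renameV : ∀ {n m} → Ren n m → VTm n → VTm m
renameV ρ (var i) = var (ρ i)
renameV ρ (lam t) = lam (renameV (ext ρ) t)
renameV ρ (app t u) = app (renameV ρ t) (renameV ρ u)
renameV ρ (es t u) = es (renameV (ext ρ) t) (renameV ρ u)

SubV : ℕ → ℕ → Set
SubV n m = Fin n → VTm m

extsV : ∀ {n m} → SubV n m → SubV (suc n) (suc m)
extsV σ zero = var zero
extsV σ (suc i) = renameV suc (σ i)

substV : ∀ {n m} → SubV n m → VTm n → VTm m
substV σ (var i) = σ i
substV σ (lam t) = lam (substV (extsV σ) t)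
substV σ (app t u) = app (substV σ t) (substV σ u)
substV σ (es t u) = es (substV (extsV σ) t) (substV σ u)

substV0 : ∀ {n} → VTm (suc n) → VTm n → VTm n
substV0 {n} t u = substV σ t
  where
  σ : SubV (suc n) n
  σ zero = u
  σ (suc i) = var i

data LCtxV : ℕ → ℕ → Set where
  □    : ∀ {n} → LCtxV n n
  _[_] : ∀ {n m} → LCtxV (suc n) m → VTm n → LCtxV n m

plugV : ∀ {n m} → LCtxV n m → VTm m → VTm n
plugV □ s = s
plugV (L [ t ]) s = es (plugV L s) t

wkLV : ∀ {n m} → LCtxV n m → Ren n m
wkLV □ = id
wkLV (L [ t ]) = wkLV L ∘ suc

data VRule : Set where
  dBᵥ sV : VRule

data _↦ᵥ[_]_ {n : ℕ} : VTm n → VRule → VTm n → Set where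
  ↦dB : ∀ {m} (L : LCtxV n m) (t : VTm (suc m)) (u : VTm n) →
        app (plugV L (lam t)) u ↦ᵥ[ dBᵥ ] plugV L (es t (renameV (wkLV L) u))
  ↦sV : ∀ {m} (t : VTm (suc n)) (L : LCtxV n m) (v : VTm m) → Value v →
        es t (plugV L v) ↦ᵥ[ sV ] plugV L (substV0 (renameV (ext (wkLV L)) t) v)

-- closure under CBV full contexts G:  t →_{G⟨R⟩} u  (for some G)
data _⟶ᵥ[_]_ : ∀ {n} → VTm n → VRule → VTm n → Set where
  root : ∀ {n R} {t u : VTm n} → t ↦ᵥ[ R ] u → t ⟶ᵥ[ R ] u
  appL : ∀ {n R} {t t' : VTm n} (u : VTm n) → t ⟶ᵥ[ R ] t' → app t u ⟶ᵥ[ R ] app t' u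
  appR : ∀ {n R} {u u' : VTm n} (t : VTm n) → u ⟶ᵥ[ R ] u' → app t u ⟶ᵥ[ R ] app t u'
  lamC : ∀ {n R} {t t' : VTm (suc n)} → t ⟶ᵥ[ R ] t' → lam t ⟶ᵥ[ R ] lam t'
  esL  : ∀ {n R} {t t' : VTm (suc n)} (u : VTm n) → t ⟶ᵥ[ R ] t' → es t u ⟶ᵥ[ R ] es t' u
  esR  : ∀ {n R} {u u' : VTm n} (t : VTm (suc n)) → u ⟶ᵥ[ R ] u' → es t u ⟶ᵥ[ R ] es t u'

ruleV : VRule → BRule
ruleV dBᵥ = dB
ruleV sV = s!

decompBang : ∀ {n} → Tm n → Maybe (Σ ℕ λ m → LCtx n m × Tm m)
decompBang (bang s) = just (_ , □ , s)
decompBang (es t u) with decompBang t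
... | just (m , L , s) = just (m , L [ u ] , s)
... | nothing = nothing
decompBang _ = nothing

appEmb : ∀ {n} → Tm n → Tm n → Tm n
appEmb tv uv with decompBang tv
... | just (m , L , s) = der (app (plug L s) uv)
... | nothing = der (app (der tv) uv)

_ᵛ : ∀ {n} → VTm n → Tm n
var x ᵛ = bang (var x)
lam t ᵛ = bang (lam (bang (t ᵛ)))
es t u ᵛ = es (t ᵛ) (u ᵛ)
app t u ᵛ = appEmb (t ᵛ) (u ᵛ)

d!-normal : ∀ {n} → Tm n → Set
d!-normal {n} u = (w : Tm n) → ¬ (u ⟶[ d! ] w)

-- (t u)ᵛ depends on whether tᵛ has the form L⟨!s⟩. Deciding this by the Boolean test isBang
-- instead of by decomposition gives an equal embedding emb, which visibly commutes with
-- renaming and with substitution of embedded values. Every step out of emb t is simulated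
-- by a CBV step t →_R u with Rᵛ = R', up to d!-steps from its target to emb u: these fire
-- the redexes der(L⟨!s⟩) created when the function part of an application turns into a
-- bang. Since d!-steps have the diamond property, d!-normal forms are unique; and emb u is
-- d!-normal, because a d!-step out of it would be simulated by a CBV rule R with Rᵛ = d!.
-- Hence u' = emb u = uᵛ.

module Submission where

open import Defs
open import Data.Bool using (Bool; true; false)
open import Data.Empty using (⊥; ⊥-elim)
open import Data.Fin using (zero; suc)
open import Data.Maybe using (Maybe; just; nothing)
open import Data.Nat using (ℕ; zero; suc)
open import Data.Product using (Σ; _×_; _,_)
open import Data.Sum using (_⊎_; inj₁; inj₂)
open import Data.Unit using (⊤; tt)
open import Function using (_∘_)
open import Relation.Binary.PropositionalEquality
  using (_≡_; refl; sym; trans; cong; cong₂; module ≡-Reasoning)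
  renaming (subst to ≡-subst)
open import Relation.Binary.Construct.Closure.ReflexiveTransitive using (Star; ε; _◅_; _◅◅_; gmap)
open import Relation.Binary.Construct.Closure.ReflexiveTransitive.Properties using (reflexive)

_⟶d!*_ : ∀ {n} → Tm n → Tm n → Set
_⟶d!*_ = Star _⟶[ d! ]_

≡⇒⟶d!* : ∀ {n} {a b : Tm n} → a ≡ b → a ⟶d!* b
≡⇒⟶d!* = reflexive _⟶[ d! ]_

isBang : ∀ {n} → Tm n → Bool
isBang (bang _) = true
isBang (es t _) = isBang t
isBang _ = false

-- L⟨!s⟩ ↦ L⟨s⟩; on terms that are not of this form the result is junk.
unbang : ∀ {n} → Tm n → Tm n
unbang (bang s) = s
unbang (es t u) = es (unbang t) u
unbang t = t

isBang-plug : ∀ {n m} (L : LCtx n m) t → isBang (plug L t) ≡ isBang t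
isBang-plug □ t = refl
isBang-plug (L [ _ ]) t = isBang-plug L t

unbang-plug : ∀ {n m} (L : LCtx n m) t → unbang (plug L t) ≡ plug L (unbang t)
unbang-plug □ t = refl
unbang-plug (L [ u ]) t = cong (λ z → es z u) (unbang-plug L t)

isBang⇒plug-bang : ∀ {n} {t : Tm n} → isBang t ≡ true →
  Σ ℕ λ m → Σ (LCtx n m) λ L → Σ (Tm m) λ s → t ≡ plug L (bang s)
isBang⇒plug-bang {t = bang s} _ = _ , □ , s , refl
isBang⇒plug-bang {t = es t u} ib with isBang⇒plug-bang {t = t} ib
... | m , L , s , refl = m , L [ u ] , s , refl

isBang-rename : ∀ {n m} (ρ : Ren n m) t → isBang (rename ρ t) ≡ isBang t
isBang-rename ρ (var i) = refl
isBang-rename ρ (app t u) = refl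
isBang-rename ρ (lam t) = refl
isBang-rename ρ (bang t) = refl
isBang-rename ρ (der t) = refl
isBang-rename ρ (es t u) = isBang-rename (ext ρ) t

unbang-rename : ∀ {n m} (ρ : Ren n m) t → unbang (rename ρ t) ≡ rename ρ (unbang t)
unbang-rename ρ (var i) = refl
unbang-rename ρ (app t u) = refl
unbang-rename ρ (lam t) = refl
unbang-rename ρ (bang t) = refl
unbang-rename ρ (der t) = refl
unbang-rename ρ (es t u) = cong (λ z → es z (rename ρ u)) (unbang-rename (ext ρ) t)

-- A substitution can change isBang t and unbang t only through a variable L⟨x⟩.
HeadNotVar : ∀ {n} → Tm n → Set
HeadNotVar (var _) = ⊥
HeadNotVar (es t _) = HeadNotVar t
HeadNotVar _ = ⊤

isBang⇒HeadNotVar : ∀ {n} (t : Tm n) → isBang t ≡ true → HeadNotVar t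
isBang⇒HeadNotVar (app t u) _ = tt
isBang⇒HeadNotVar (lam t) _ = tt
isBang⇒HeadNotVar (bang t) _ = tt
isBang⇒HeadNotVar (der t) _ = tt
isBang⇒HeadNotVar (es t u) ib = isBang⇒HeadNotVar t ib

isBang-subst : ∀ {n m} (σ : Sub n m) t → HeadNotVar t → isBang (subst σ t) ≡ isBang t
isBang-subst σ (app t u) _ = refl
isBang-subst σ (lam t) _ = refl
isBang-subst σ (bang t) _ = refl
isBang-subst σ (der t) _ = refl
isBang-subst σ (es t u) h = isBang-subst (exts σ) t h

unbang-subst : ∀ {n m} (σ : Sub n m) t → HeadNotVar t → unbang (subst σ t) ≡ subst σ (unbang t)
unbang-subst σ (app t u) _ = refl
unbang-subst σ (lam t) _ = refl
unbang-subst σ (bang t) _ = refl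
unbang-subst σ (der t) _ = refl
unbang-subst σ (es t u) h = cong (λ z → es z (subst σ u)) (unbang-subst (exts σ) t h)

embApp : ∀ {n} → Bool → Tm n → Tm n → Tm n
embApp true tv uv = der (app (unbang tv) uv)
embApp false tv uv = der (app (der tv) uv)

emb : ∀ {n} → VTm n → Tm n
emb (var x) = bang (var x)
emb (lam t) = bang (lam (bang (emb t)))
emb (es t u) = es (emb t) (emb u)
emb (app t u) = embApp (isBang (emb t)) (emb t) (emb u)

DecompBangSpec : ∀ {n} → Tm n → Maybe (Σ ℕ λ m → LCtx n m × Tm m) → Set
DecompBangSpec t (just (m , L , s)) = isBang t ≡ true × unbang t ≡ plug L s
DecompBangSpec t nothing = isBang t ≡ false

decompBang-spec : ∀ {n} (t : Tm n) → DecompBangSpec t (decompBang t)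
decompBang-spec (var x) = refl
decompBang-spec (app t u) = refl
decompBang-spec (lam t) = refl
decompBang-spec (bang s) = refl , refl
decompBang-spec (der t) = refl
decompBang-spec (es t u) with decompBang t | decompBang-spec t
... | just _ | ib , e = ib , cong (λ z → es z u) e
... | nothing | ib = ib

appEmb≡embApp : ∀ {n} (tv uv : Tm n) → appEmb tv uv ≡ embApp (isBang tv) tv uv
appEmb≡embApp tv uv with decompBang tv | decompBang-spec tv
... | just (m , L , s) | ib , e rewrite ib = cong (λ z → der (app z uv)) (sym e)
... | nothing | ib rewrite ib = refl

emb≡ᵛ : ∀ {n} (t : VTm n) → emb t ≡ t ᵛ
emb≡ᵛ (var x) = refl
emb≡ᵛ (lam t) = cong (λ z → bang (lam (bang z))) (emb≡ᵛ t)
emb≡ᵛ (es t u) = cong₂ es (emb≡ᵛ t) (emb≡ᵛ u)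
emb≡ᵛ (app t u) = begin
  embApp (isBang (emb t)) (emb t) (emb u)  ≡⟨ cong₂ (λ x y → embApp (isBang x) x y) (emb≡ᵛ t) (emb≡ᵛ u) ⟩
  embApp (isBang (t ᵛ)) (t ᵛ) (u ᵛ)        ≡⟨ sym (appEmb≡embApp (t ᵛ) (u ᵛ)) ⟩
  appEmb (t ᵛ) (u ᵛ)                       ∎
  where open ≡-Reasoning

HeadNotVar-emb : ∀ {n} (t : VTm n) → HeadNotVar (emb t)
HeadNotVar-emb (var x) = tt
HeadNotVar-emb (lam t) = tt
HeadNotVar-emb (es t u) = HeadNotVar-emb t
HeadNotVar-emb (app t u) with isBang (emb t)
... | true = tt
... | false = tt

emb-renameV : ∀ {n m} (ρ : Ren n m) t → emb (renameV ρ t) ≡ rename ρ (emb t)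
emb-renameV ρ (var i) = refl
emb-renameV ρ (lam t) = cong (λ z → bang (lam (bang z))) (emb-renameV (ext ρ) t)
emb-renameV ρ (es t u) = cong₂ es (emb-renameV (ext ρ) t) (emb-renameV ρ u)
emb-renameV ρ (app t u) = begin
  embApp (isBang (emb (renameV ρ t))) (emb (renameV ρ t)) (emb (renameV ρ u))
    ≡⟨ cong₂ (λ x y → embApp (isBang x) x y) (emb-renameV ρ t) (emb-renameV ρ u) ⟩
  embApp (isBang (rename ρ (emb t))) (rename ρ (emb t)) (rename ρ (emb u))
    ≡⟨ cong (λ β → embApp β (rename ρ (emb t)) (rename ρ (emb u))) (isBang-rename ρ (emb t)) ⟩
  embApp (isBang (emb t)) (rename ρ (emb t)) (rename ρ (emb u))
    ≡⟨ embApp-rename (isBang (emb t)) ⟩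
  rename ρ (embApp (isBang (emb t)) (emb t) (emb u))
    ∎
  where
  open ≡-Reasoning
  embApp-rename : ∀ β → embApp β (rename ρ (emb t)) (rename ρ (emb u)) ≡ rename ρ (embApp β (emb t) (emb u))
  embApp-rename true = cong (λ z → der (app z (rename ρ (emb u)))) (unbang-rename ρ (emb t))
  embApp-rename false = refl

EmbedsAs : ∀ {n m} → SubV n m → Sub n m → Set
EmbedsAs σ σ' = ∀ i → emb (σ i) ≡ bang (σ' i)

EmbedsAs-exts : ∀ {n m} {σ : SubV n m} {σ' : Sub n m} → EmbedsAs σ σ' → EmbedsAs (extsV σ) (exts σ')
EmbedsAs-exts h zero = refl
EmbedsAs-exts {σ = σ} h (suc i) = trans (emb-renameV suc (σ i)) (cong (rename suc) (h i))

emb-substV : ∀ {n m} {σ : SubV n m} {σ' : Sub n m} → EmbedsAs σ σ' →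
  ∀ t → emb (substV σ t) ≡ subst σ' (emb t)
emb-substV h (var i) = h i
emb-substV h (lam t) = cong (λ z → bang (lam (bang z))) (emb-substV (EmbedsAs-exts h) t)
emb-substV h (es t u) = cong₂ es (emb-substV (EmbedsAs-exts h) t) (emb-substV h u)
emb-substV {σ = σ} {σ'} h (app t u) = begin
  embApp (isBang (emb (substV σ t))) (emb (substV σ t)) (emb (substV σ u))
    ≡⟨ cong₂ (λ x y → embApp (isBang x) x y) (emb-substV h t) (emb-substV h u) ⟩
  embApp (isBang (subst σ' (emb t))) (subst σ' (emb t)) (subst σ' (emb u))
    ≡⟨ cong (λ β → embApp β (subst σ' (emb t)) (subst σ' (emb u)))
            (isBang-subst σ' (emb t) (HeadNotVar-emb t)) ⟩
  embApp (isBang (emb t)) (subst σ' (emb t)) (subst σ' (emb u))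
    ≡⟨ embApp-subst (isBang (emb t)) ⟩
  subst σ' (embApp (isBang (emb t)) (emb t) (emb u))
    ∎
  where
  open ≡-Reasoning
  embApp-subst : ∀ β → embApp β (subst σ' (emb t)) (subst σ' (emb u)) ≡ subst σ' (embApp β (emb t) (emb u))
  embApp-subst true =
    cong (λ z → der (app z (subst σ' (emb u)))) (unbang-subst σ' (emb t) (HeadNotVar-emb t))
  embApp-subst false = refl

emb-substV0 : ∀ {n} {v : VTm n} {s : Tm n} → emb v ≡ bang s → ∀ t → emb (substV0 t v) ≡ subst0 (emb t) s
emb-substV0 e t = emb-substV (λ { zero → e ; (suc i) → refl }) t

emb-app-¬isBang : ∀ {n} (a b : VTm n) → isBang (emb (app a b)) ≡ true → ⊥
emb-app-¬isBang a b with isBang (emb a)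
... | true = λ ()
... | false = λ ()

embL : ∀ {n m} → LCtxV n m → LCtx n m
embL □ = □
embL (L [ t ]) = embL L [ emb t ]

emb-plugV : ∀ {n m} (L : LCtxV n m) t → emb (plugV L t) ≡ plug (embL L) (emb t)
emb-plugV □ t = refl
emb-plugV (L [ u ]) t = cong (λ z → es z (emb u)) (emb-plugV L t)

wkL-embL : ∀ {n m} (L : LCtxV n m) → wkL (embL L) ≡ wkLV L
wkL-embL □ = refl
wkL-embL (L [ _ ]) = cong (_∘ suc) (wkL-embL L)

emb-↦dB-contractum : ∀ {n m} (L : LCtxV n m) t (u : VTm n) →
  emb (plugV L (es t (renameV (wkLV L) u))) ≡ plug (embL L) (es (emb t) (rename (wkL (embL L)) (emb u)))
emb-↦dB-contractum L t u = begin
  emb (plugV L (es t (renameV (wkLV L) u)))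
    ≡⟨ emb-plugV L _ ⟩
  plug (embL L) (es (emb t) (emb (renameV (wkLV L) u)))
    ≡⟨ cong (λ z → plug (embL L) (es (emb t) z)) (emb-renameV (wkLV L) u) ⟩
  plug (embL L) (es (emb t) (rename (wkLV L) (emb u)))
    ≡⟨ cong (λ ρ → plug (embL L) (es (emb t) (rename ρ (emb u)))) (sym (wkL-embL L)) ⟩
  plug (embL L) (es (emb t) (rename (wkL (embL L)) (emb u)))
    ∎
  where open ≡-Reasoning

emb-↦sV-contractum : ∀ {n m} (t : VTm (suc n)) (L : LCtxV n m) {v : VTm m} {s : Tm m} → emb v ≡ bang s →
  emb (plugV L (substV0 (renameV (ext (wkLV L)) t) v)) ≡
  plug (embL L) (subst0 (rename (ext (wkL (embL L))) (emb t)) s)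
emb-↦sV-contractum t L {v} {s} ev = begin
  emb (plugV L (substV0 (renameV (ext (wkLV L)) t) v))
    ≡⟨ emb-plugV L _ ⟩
  plug (embL L) (emb (substV0 (renameV (ext (wkLV L)) t) v))
    ≡⟨ cong (plug (embL L)) (emb-substV0 ev (renameV (ext (wkLV L)) t)) ⟩
  plug (embL L) (subst0 (emb (renameV (ext (wkLV L)) t)) s)
    ≡⟨ cong (λ z → plug (embL L) (subst0 z s)) (emb-renameV _ t) ⟩
  plug (embL L) (subst0 (rename (ext (wkLV L)) (emb t)) s)
    ≡⟨ cong (λ ρ → plug (embL L) (subst0 (rename (ext ρ) (emb t)) s)) (sym (wkL-embL L)) ⟩
  plug (embL L) (subst0 (rename (ext (wkL (embL L))) (emb t)) s)
    ∎
  where open ≡-Reasoning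

es-injective : ∀ {n} {t t' : Tm (suc n)} {u u' : Tm n} → es t u ≡ es t' u' → t ≡ t' × u ≡ u'
es-injective refl = refl , refl

emb≡plug-bang⇒plugV-value : ∀ {n m} (a : VTm n) (L : LCtx n m) (s : Tm m) → emb a ≡ plug L (bang s) →
  Σ (LCtxV n m) λ Lv → Σ (VTm m) λ v → Value v × a ≡ plugV Lv v × L ≡ embL Lv × emb v ≡ bang s
emb≡plug-bang⇒plugV-value (var x) □ _ refl = □ , var x , var x , refl , refl , refl
emb≡plug-bang⇒plugV-value (lam t) □ _ refl = □ , lam t , lam t , refl , refl , refl
emb≡plug-bang⇒plugV-value (es a b) (L [ _ ]) s e with es-injective e
... | e₁ , refl with emb≡plug-bang⇒plugV-value a L s e₁
... | Lv , v , val , refl , refl , ev = Lv [ b ] , v , val , refl , refl , ev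
emb≡plug-bang⇒plugV-value (app a b) L s e =
  ⊥-elim (emb-app-¬isBang a b (trans (cong isBang e) (isBang-plug L (bang s))))

unbang-emb≡plug-lam⇒plugV-lam : ∀ {n m} (b : VTm n) (L : LCtx n m) (c : Tm (suc m)) →
  isBang (emb b) ≡ true → unbang (emb b) ≡ plug L (lam c) →
  Σ (LCtxV n m) λ Lv → Σ (VTm (suc m)) λ t → b ≡ plugV Lv (lam t) × L ≡ embL Lv × c ≡ bang (emb t)
unbang-emb≡plug-lam⇒plugV-lam (lam t) □ _ _ refl = □ , t , refl , refl , refl
unbang-emb≡plug-lam⇒plugV-lam (es b a) (L [ _ ]) c ib e with es-injective e
... | e₁ , refl with unbang-emb≡plug-lam⇒plugV-lam b L c ib e₁
... | Lv , t , refl , refl , refl = Lv [ a ] , t , refl , refl , refl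
unbang-emb≡plug-lam⇒plugV-lam (app b a) L c ib e = ⊥-elim (emb-app-¬isBang b a ib)

der-↦-inv : ∀ {n R} {t w : Tm n} → der t ↦[ R ] w → R ≡ d! × isBang t ≡ true × w ≡ unbang t
der-↦-inv (↦d! L t) = refl , isBang-plug L (bang t) , sym (unbang-plug L (bang t))

app-↦-inv : ∀ {n R} {t u w : Tm n} → app t u ↦[ R ] w →
  R ≡ dB × Σ ℕ λ m → Σ (LCtx n m) λ L → Σ (Tm (suc m)) λ c →
    t ≡ plug L (lam c) × w ≡ plug L (es c (rename (wkL L) u))
app-↦-inv (↦dB L c u) = refl , _ , L , c , refl , refl

es-↦-inv : ∀ {n R} {t : Tm (suc n)} {u w : Tm n} → es t u ↦[ R ] w →
  R ≡ s! × Σ ℕ λ m → Σ (LCtx n m) λ L → Σ (Tm m) λ s →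
    u ≡ plug L (bang s) × w ≡ plug L (subst0 (rename (ext (wkL L)) t) s)
es-↦-inv (↦s! t L s) = refl , _ , L , s , refl , refl

der-⟶-unbang : ∀ {n} {t : Tm n} → isBang t ≡ true → der t ⟶[ d! ] unbang t
der-⟶-unbang {t = t} ib with isBang⇒plug-bang {t = t} ib
... | _ , L , s , refl =
  ≡-subst (der (plug L (bang s)) ⟶[ d! ]_) (sym (unbang-plug L (bang s))) (root (↦d! L s))

unbang-plug-subst-rename : ∀ {n m k j} (L : LCtx n m) (σ : Sub j m) (ρ : Ren k j) (t : Tm k) → isBang t ≡ true →
  isBang (plug L (subst σ (rename ρ t))) ≡ true ×
  unbang (plug L (subst σ (rename ρ t))) ≡ plug L (subst σ (rename ρ (unbang t)))
unbang-plug-subst-rename L σ ρ t ib =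
  trans (isBang-plug L _) (trans (isBang-subst σ (rename ρ t) hnv) (trans (isBang-rename ρ t) ib)) ,
  trans (unbang-plug L _)
    (cong (plug L) (trans (unbang-subst σ (rename ρ t) hnv) (cong (subst σ) (unbang-rename ρ t))))
  where
  hnv : HeadNotVar (rename ρ t)
  hnv = isBang⇒HeadNotVar (rename ρ t) (trans (isBang-rename ρ t) ib)

unbang-⟶ : ∀ {n R} {t t' : Tm n} → isBang t ≡ true → t ⟶[ R ] t' → isBang t' ≡ true × unbang t ⟶[ R ] unbang t'
unbang-⟶ {t = bang s} _ (bangC p) = refl , p
unbang-⟶ {t = es t u} ib (root r) with es-↦-inv r
... | refl , _ , L , s , refl , refl with unbang-plug-subst-rename L _ (ext (wkL L)) t ib
... | ib' , e = ib' , ≡-subst (es (unbang t) (plug L (bang s)) ⟶[ s! ]_) (sym e) (root (↦s! (unbang t) L s))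
unbang-⟶ {t = es t u} ib (esL _ p) with unbang-⟶ ib p
... | ib' , p' = ib' , esL u p'
unbang-⟶ {t = es t u} ib (esR _ p) = ib , esR (unbang t) p

unbang-⟶⁻¹ : ∀ {n R} {t w : Tm n} → isBang t ≡ true → unbang t ⟶[ R ] w →
  Σ (Tm n) λ t' → (t ⟶[ R ] t') × isBang t' ≡ true × unbang t' ≡ w
unbang-⟶⁻¹ {t = bang s} _ p = bang _ , bangC p , refl , refl
unbang-⟶⁻¹ {t = es t u} ib (root r) with es-↦-inv r
... | refl , _ , L , s , refl , refl with unbang-plug-subst-rename L _ (ext (wkL L)) t ib
... | ib' , e = _ , root (↦s! t L s) , ib' , e
unbang-⟶⁻¹ {t = es t u} ib (esL _ p) with unbang-⟶⁻¹ ib p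
... | t' , p' , ib' , refl = es t' u , esL u p' , ib' , refl
unbang-⟶⁻¹ {t = es t u} ib (esR _ p) = es t _ , esR t p , ib , refl

unbang-⟶d!* : ∀ {n} {t t' : Tm n} → isBang t ≡ true → t ⟶d!* t' → isBang t' ≡ true × unbang t ⟶d!* unbang t'
unbang-⟶d!* ib ε = ib , ε
unbang-⟶d!* ib (p ◅ ps) with unbang-⟶ ib p
... | ib' , p' with unbang-⟶d!* ib' ps
... | ib'' , ps' = ib'' , p' ◅ ps'

der-plug-es-bang-⟶ : ∀ {n m} (L : LCtx n m) (t : Tm (suc m)) u →
  der (plug L (es (bang t) u)) ⟶[ d! ] plug L (es t u)
der-plug-es-bang-⟶ L t u =
  ≡-subst (der (plug L (es (bang t) u)) ⟶[ d! ]_) (unbang-plug L (es (bang t) u))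
    (der-⟶-unbang (isBang-plug L (es (bang t) u)))

der-app-der-⟶d!* : ∀ {n} (t u : Tm n) → der (app (der t) u) ⟶d!* embApp (isBang t) t u
der-app-der-⟶d!* t u with isBang t in ib
... | true = derC (appL u (der-⟶-unbang ib)) ◅ ε
... | false = ε

der≢plug-lam : ∀ {n m} (L : LCtx n m) {t : Tm n} {c : Tm (suc m)} → der t ≡ plug L (lam c) → ⊥
der≢plug-lam □ ()
der≢plug-lam (L [ _ ]) ()

record Simulation {n} (t : VTm n) (R' : BRule) (w : Tm n) : Set where
  constructor simulation
  field
    target   : VTm n
    rule     : VRule
    rule-ᵛ   : ruleV rule ≡ R'
    step     : t ⟶ᵥ[ rule ] target
    d!-joins : w ⟶d!* emb target

simulation-cong : ∀ {n m} {t : VTm n} {R' w} (f : VTm n → VTm m) (g : Tm n → Tm m) →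
  (∀ {R a b} → a ⟶ᵥ[ R ] b → f a ⟶ᵥ[ R ] f b) → (∀ {a b} → a ⟶[ d! ] b → g a ⟶[ d! ] g b) →
  (∀ u → g (emb u) ⟶d!* emb (f u)) → Simulation t R' w → Simulation (f t) R' (g w)
simulation-cong f g f-step g-step g-emb (simulation u R e s st) =
  simulation (f u) R e (f-step s) (gmap g g-step st ◅◅ g-emb u)

mutual
  simulate : ∀ {n} (t : VTm n) {R' w} → emb t ⟶[ R' ] w → Simulation t R' w
  simulate (var x) (root ())
  simulate (var x) (bangC (root ()))
  simulate (lam t) (root ())
  simulate (lam t) (bangC (root ()))
  simulate (lam t) (bangC (lamC (root ())))
  simulate (lam t) (bangC (lamC (bangC p))) =
    simulation-cong lam (λ x → bang (lam (bang x))) lamC (λ q → bangC (lamC (bangC q))) (λ _ → ε) (simulate t p)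
  simulate (es t u) (root r) with es-↦-inv r
  ... | refl , _ , L , s , e , refl with emb≡plug-bang⇒plugV-value u L s e
  ... | Lv , v , val , refl , refl , ev =
    simulation _ sV refl (root (↦sV t Lv v val)) (≡⇒⟶d!* (sym (emb-↦sV-contractum t Lv ev)))
  simulate (es t u) (esL _ p) =
    simulation-cong (λ x → es x u) (λ x → es x (emb u)) (esL u) (esL (emb u)) (λ _ → ε) (simulate t p)
  simulate (es t u) (esR _ p) =
    simulation-cong (es t) (es (emb t)) (esR t) (esR (emb t)) (λ _ → ε) (simulate u p)
  simulate (app t u) p = simulate-app t u _ refl p

  simulate-app : ∀ {n} (t u : VTm n) β → isBang (emb t) ≡ β →
    ∀ {R' w} → embApp β (emb t) (emb u) ⟶[ R' ] w → Simulation (app t u) R' w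
  simulate-app t u true ib (root r) with der-↦-inv r
  ... | _ , () , _
  simulate-app t u true ib (derC (root r)) with app-↦-inv r
  ... | refl , _ , L , c , e , refl with unbang-emb≡plug-lam⇒plugV-lam t L c ib e
  ... | Lv , b , refl , refl , refl =
    simulation _ dBᵥ refl (root (↦dB Lv b u))
      (der-plug-es-bang-⟶ (embL Lv) (emb b) _ ◅ ≡⇒⟶d!* (sym (emb-↦dB-contractum Lv b u)))
  simulate-app t u true ib (derC (appL _ p)) with unbang-⟶⁻¹ ib p
  ... | _ , p' , ib' , refl with simulate t p'
  ... | simulation t' R e s st with unbang-⟶d!* ib' st
  ... | ib'' , st' =
    simulation (app t' u) R e (appL u s)
      (gmap (λ x → der (app x (emb u))) (λ q → derC (appL _ q)) st'
       ◅◅ ≡⇒⟶d!* (cong (λ β → embApp β (emb t') (emb u)) (sym ib'')))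
  simulate-app t u true ib (derC (appR _ p)) =
    simulation-cong (app t) (λ x → der (app (unbang (emb t)) x)) (appR t) (λ q → derC (appR _ q))
      (λ u' → ≡⇒⟶d!* (cong (λ β → embApp β (emb t) (emb u')) (sym ib))) (simulate u p)
  simulate-app t u false ib (root r) with der-↦-inv r
  ... | _ , () , _
  simulate-app t u false ib (derC (root r)) with app-↦-inv r
  ... | refl , _ , L , _ , e , refl = ⊥-elim (der≢plug-lam L e)
  simulate-app t u false ib (derC (appL _ (root r))) with der-↦-inv r
  ... | _ , ib' , _ with trans (sym ib) ib'
  ... | ()
  simulate-app t u false ib (derC (appL _ (derC p))) =
    simulation-cong (λ x → app x u) (λ x → der (app (der x) (emb u))) (appL u) (λ q → derC (appL _ (derC q)))
      (λ t' → der-app-der-⟶d!* (emb t') (emb u)) (simulate t p)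
  simulate-app t u false ib (derC (appR _ p)) =
    simulation-cong (app t) (λ x → der (app (der (emb t)) x)) (appR t) (λ q → derC (appR _ q))
      (λ u' → ≡⇒⟶d!* (cong (λ β → embApp β (emb t) (emb u')) (sym ib))) (simulate u p)

Joinable : ∀ {n} → Tm n → Tm n → Set
Joinable {n} a b = a ≡ b ⊎ Σ (Tm n) λ c → (a ⟶[ d! ] c) × (b ⟶[ d! ] c)

Joinable-sym : ∀ {n} {a b : Tm n} → Joinable a b → Joinable b a
Joinable-sym (inj₁ e) = inj₁ (sym e)
Joinable-sym (inj₂ (c , p , q)) = inj₂ (c , q , p)

Joinable-cong : ∀ {n m} (f : Tm n → Tm m) → (∀ {a b} → a ⟶[ d! ] b → f a ⟶[ d! ] f b) →
  ∀ {a b} → Joinable a b → Joinable (f a) (f b)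
Joinable-cong f f-step (inj₁ e) = inj₁ (cong f e)
Joinable-cong f f-step (inj₂ (c , p , q)) = inj₂ (f c , f-step p , f-step q)

der-⟶-Joinable-unbang : ∀ {n} {t w : Tm n} → isBang t ≡ true → der t ⟶[ d! ] w → Joinable (unbang t) w
der-⟶-Joinable-unbang ib (root r) with der-↦-inv r
... | _ , _ , refl = inj₁ refl
der-⟶-Joinable-unbang ib (derC p) with unbang-⟶ ib p
... | ib' , p' = inj₂ (_ , p' , der-⟶-unbang ib')

d!-diamond : ∀ {n} {t a b : Tm n} → t ⟶[ d! ] a → t ⟶[ d! ] b → Joinable a b
d!-diamond {b = b} (root (↦d! L s)) q =
  ≡-subst (λ a → Joinable a b) (unbang-plug L (bang s)) (der-⟶-Joinable-unbang (isBang-plug L (bang s)) q)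
d!-diamond p (root r@(↦d! _ _)) = Joinable-sym (d!-diamond (root r) p)
d!-diamond (appL u p) (appL _ q) = Joinable-cong (λ x → app x u) (appL u) (d!-diamond p q)
d!-diamond (appL u p) (appR _ q) = inj₂ (_ , appR _ q , appL _ p)
d!-diamond (appR t p) (appL _ q) = inj₂ (_ , appL _ q , appR _ p)
d!-diamond (appR t p) (appR _ q) = Joinable-cong (app t) (appR t) (d!-diamond p q)
d!-diamond (lamC p) (lamC q) = Joinable-cong lam lamC (d!-diamond p q)
d!-diamond (bangC p) (bangC q) = Joinable-cong bang bangC (d!-diamond p q)
d!-diamond (derC p) (derC q) = Joinable-cong der derC (d!-diamond p q)
d!-diamond (esL u p) (esL _ q) = Joinable-cong (λ x → es x u) (esL u) (d!-diamond p q)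
d!-diamond (esL u p) (esR _ q) = inj₂ (_ , esR _ q , esL _ p)
d!-diamond (esR t p) (esL _ q) = inj₂ (_ , esL _ q , esR _ p)
d!-diamond (esR t p) (esR _ q) = Joinable-cong (es t) (esR t) (d!-diamond p q)

⟶d!*-normal-form-after-step : ∀ {n} {t a v : Tm n} → d!-normal v → t ⟶[ d! ] a → t ⟶d!* v → a ⟶d!* v
⟶d!*-normal-form-after-step nf p ε = ⊥-elim (nf _ p)
⟶d!*-normal-form-after-step nf p (q ◅ qs) with d!-diamond p q
... | inj₁ refl = qs
... | inj₂ (_ , p' , q') = p' ◅ ⟶d!*-normal-form-after-step nf q' qs

d!-normal-form-unique : ∀ {n} {t v v' : Tm n} → d!-normal v → d!-normal v' → t ⟶d!* v → t ⟶d!* v' → v ≡ v'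
d!-normal-form-unique nf nf' ε ε = refl
d!-normal-form-unique nf nf' ε (q ◅ _) = ⊥-elim (nf _ q)
d!-normal-form-unique nf nf' (p ◅ ps) qs = d!-normal-form-unique nf nf' ps (⟶d!*-normal-form-after-step nf' p qs)

emb-d!-normal : ∀ {n} (u : VTm n) → d!-normal (emb u)
emb-d!-normal u w p with simulate u p
... | simulation _ dBᵥ () _ _
... | simulation _ sV () _ _

lemma6 : ∀ {n} (t : VTm n) (u' : Tm n) (R' : BRule) (w : Tm n) →
    d!-normal u' →
    (t ᵛ) ⟶[ R' ] w →
    Star _⟶[ d! ]_ w u' →
    Σ (VTm n) λ u → (u ᵛ ≡ u') × Σ VRule λ R → (ruleV R ≡ R') × (t ⟶ᵥ[ R ] u)
lemma6 t u' R' w nf p st with simulate t (≡-subst (_⟶[ R' ] w) (sym (emb≡ᵛ t)) p)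
... | simulation u R e s st' =
  u , trans (sym (emb≡ᵛ u)) (d!-normal-form-unique (emb-d!-normal u) nf st' st) , R , e , s
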